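{- Let $\mathsf K$ be the set of $n\times\ell$ binary matrices $M$ associated to bikeys $b\in F(s)$. Then $$\mathsf K=\bigcup_{\lambda\in\mathcal S(s)}\{P_wM_\lambda P_{\dot w}: w\in S_n,\ \dot w\in S_\ell\},$$ and $$\sum_{(m_{i,j})\in\mathsf K}\ \prod_{1\le i\le n,\ 1\le j\le \ell}(x_iy_j)^{m_{i,j}}=\sum_{\lambda\in\mathcal S(s)}m_\lambda(x)\,m_{\lambda^{\mathrm{tr}}}(y).$$
   Context: Fix integers $n,\ell\ge2$, $s\ge0$. $F(s)$ is the set of $b=c_\ell\otimes\cdots\otimes c_1$ with $c_j\subseteq\{1,\dots,n\}$ and $\sum_j|c_j|=s$. The binary matrix of $b$ is the $n\times\ell$ matrix $M$ with $M_{i,j}=1$ if $i\in c_j$ and $0$ otherwise. A bikey is an element $b\in F(s)$ whose columns $c_1,\dots,c_\ell$ are totally ordered by inclusion. $\mathcal S(s)$ is the set of partitions $\lambda=(\lambda_1,\dots,\lambda_n)$ of $s$ with at most $n$ parts and $\lambda_1\le\ell$; $M_\lambda$ is the $n\times\ell$ binary matrix with $(M_\lambda)_{i,j}=1$ iff $j\le\lambda_i$. For permutations $w\in S_n$, $\dot w\in S_\ell$, $P_w$ and $P_{\dot w}$ are the corresponding permutation matrices (left multiplication permutes rows, right multiplication permutes columns). $x=(x_1,\dots,x_n)$, $y=(y_1,\dots,y_\ell)$; $m_\lambda(x)$ is the monomial symmetric polynomial in $x_1,\dots,x_n$ and $m_{\lambda^{\mathrm{tr}}}(y)$ the monomial symmetric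 polynomial in $y_1,\dots,y_\ell$ indexed by the conjugate partition. -}

module Defs where

open import Level using (Level)
open import Data.Nat using (ℕ; zero; suc; _≤_; _≤?_; _<ᵇ_)
open import Data.Nat.Properties using (_≟_)
open import Data.Fin using (Fin; toℕ)
open import Data.Fin.Properties using (all?)
open import Data.Fin.Subset using (Subset; _⊆_; ∣_∣; inside; outside)
open import Data.Fin.Subset.Properties using (_⊆?_)
open import Data.Fin.Permutation using (Permutation′; _⟨$⟩ʳ_; _⟨$⟩ˡ_)
open import Data.Bool using (Bool; true; false; if_then_else_)
open import Data.Vec as V using (Vec; lookup; toList)
open import Data.List as L using (List; []; _∷_; _++_; map; concatMap; filter)
open import Data.List.Membership.Propositional using (_∈_)
open import Data.List.Membership.Propositional.Properties using (∈-∃++)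
open import Data.List.Relation.Unary.Any using (here; there)
import Data.List.Relation.Unary.Any as Any
open import Data.List.Relation.Binary.Permutation.Propositional
  using (_↭_; ↭-refl; ↭-prep; ↭-trans; ↭-sym; ↭-reflexive)
open import Data.List.Relation.Binary.Permutation.Propositional.Properties
  using (shift; drop-∷; ∈-resp-↭; ↭-empty-inv)
open import Data.Product using (Σ; _×_; _,_; ∃)
open import Data.Sum using (_⊎_)
open import Relation.Nullary using (Dec; yes; no; ¬_)
open import Relation.Nullary.Decidable using (_×-dec_; _⊎-dec_; _→-dec_)
open import Relation.Binary.PropositionalEquality using (_≡_; refl; sym; subst)
open import Algebra.Bundles using (CommutativeSemiring)

allVecs : ∀ {a} {A : Set a} (k : ℕ) → List A → List (Vec A k)
allVecs zero    xs = V.[] ∷ []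
allVecs (suc k) xs = concatMap (λ a → map (a V.∷_) (allVecs k xs)) xs

range : ℕ → List ℕ
range m = L.upTo m

-- Tensors b = c_ℓ ⊗ ⋯ ⊗ c_1, stored as the vector of columns (c_1,…,c_ℓ);
-- index j : Fin ℓ stands for column c_{j+1}.

Tensor : ℕ → ℕ → Set
Tensor n ℓ = Vec (Subset n) ℓ

size : ∀ {n ℓ} → Tensor n ℓ → ℕ
size b = V.sum (V.map ∣_∣ b)

InF : ∀ {n ℓ} → ℕ → Tensor n ℓ → Set
InF s b = size b ≡ s

ColumnsChain : ∀ {n ℓ} → Tensor n ℓ → Set
ColumnsChain b = ∀ j j' → lookup b j ⊆ lookup b j' ⊎ lookup b j' ⊆ lookup b j

IsBikey : ∀ {n ℓ} → ℕ → Tensor n ℓ → Set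
IsBikey s b = InF s b × ColumnsChain b

IsBikey? : ∀ {n ℓ} (s : ℕ) (b : Tensor n ℓ) → Dec (IsBikey s b)
IsBikey? s b = (size b ≟ s) ×-dec
  all? (λ j → all? (λ j' → (lookup b j ⊆? lookup b j') ⊎-dec (lookup b j' ⊆? lookup b j)))

allTensors : (n ℓ : ℕ) → List (Tensor n ℓ)
allTensors n ℓ = allVecs ℓ (allVecs n (inside ∷ outside ∷ []))

BinMat : ℕ → ℕ → Set
BinMat n ℓ = Fin n → Fin ℓ → Bool

matrixOf : ∀ {n ℓ} → Tensor n ℓ → BinMat n ℓ
matrixOf b i j = lookup (lookup b j) i

InK : ∀ {n ℓ} → ℕ → BinMat n ℓ → Set
InK {n} {ℓ} s M = Σ (Tensor n ℓ) λ b → IsBikey s b × (∀ i j → M i j ≡ matrixOf b i j)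

-- Partitions λ ∈ 𝒮(s): λ = (λ_1,…,λ_n) (padded with zeros), weakly decreasing,
-- λ_1 ≤ ℓ, Σ λ_i = s.  Index i : Fin n stands for λ_{i+1}.

IsPartitionIn : (n ℓ s : ℕ) → Vec ℕ n → Set
IsPartitionIn n ℓ s λp =
  (∀ i j → toℕ i ≤ toℕ j → lookup λp j ≤ lookup λp i)
  × (∀ i → lookup λp i ≤ ℓ)
  × V.sum λp ≡ s

IsPartitionIn? : (n ℓ s : ℕ) (λp : Vec ℕ n) → Dec (IsPartitionIn n ℓ s λp)
IsPartitionIn? n ℓ s λp =
  all? (λ i → all? (λ j → (toℕ i ≤? toℕ j) →-dec (lookup λp j ≤? lookup λp i)))
  ×-dec all? (λ i → lookup λp i ≤? ℓ)
  ×-dec (V.sum λp ≟ s)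

-- the list 𝒮(s) (all entries lie in 0..ℓ)
partitions : (n ℓ s : ℕ) → List (Vec ℕ n)
partitions n ℓ s = filter (IsPartitionIn? n ℓ s) (allVecs n (range (suc ℓ)))

-- M_λ : (M_λ)_{i,j} = 1 iff j ≤ λ_i   (1-indexed; here toℕ j < λ_{i+1})
Mλ : ∀ {n ℓ} → Vec ℕ n → BinMat n ℓ
Mλ λp i j = toℕ j <ᵇ lookup λp i

-- P_w M P_{ẇ} : (P_w M P_ẇ)_{i,j} = M_{w⁻¹(i), ẇ(j)}
permMat : ∀ {n ℓ} → Permutation′ n → BinMat n ℓ → Permutation′ ℓ → BinMat n ℓ
permMat w M w' i j = M (w ⟨$⟩ˡ i) (w' ⟨$⟩ʳ j)

InUnion : ∀ {n ℓ} → ℕ → BinMat n ℓ → Set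
InUnion {n} {ℓ} s M =
  Σ (Vec ℕ n) λ λp → IsPartitionIn n ℓ s λp ×
  Σ (Permutation′ n) λ w → Σ (Permutation′ ℓ) λ w' →
  ∀ i j → M i j ≡ permMat w (Mλ λp) w' i j

-- conjugate partition, restricted to its first ℓ entries:
-- λ^tr_j = #{ i : λ_i ≥ j },  j = 1..ℓ
conj : ∀ {n} (ℓ : ℕ) → Vec ℕ n → Vec ℕ ℓ
conj ℓ λp = V.tabulate (λ j → V.count (λ v → suc (toℕ j) ≤? v) λp)

private
  remove-↭ : ∀ {x : ℕ} {xs} ws zs → xs ↭ ws ++ zs → x ∷ xs ↭ ws ++ x ∷ zs
  remove-↭ {x} ws zs p = ↭-trans (↭-prep x p) (↭-sym (shift x ws zs))

  remove-↭⁻ : ∀ {x : ℕ} {xs} ws zs → x ∷ xs ↭ ws ++ x ∷ zs → xs ↭ ws ++ zs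
  remove-↭⁻ {x} ws zs p = drop-∷ (↭-trans p (shift x ws zs))

_↭?_ : (xs ys : List ℕ) → Dec (xs ↭ ys)
[] ↭? [] = yes ↭-refl
[] ↭? (y ∷ ys) = no λ p → case (↭-empty-inv (↭-sym p))
  where case : y ∷ ys ≡ [] → _
        case ()
(x ∷ xs) ↭? ys with Any.any? (x ≟_) ys
... | no x∉ys = no λ p → x∉ys (∈-resp-↭ p (here refl))
... | yes x∈ys with ∈-∃++ x∈ys
... | ws , zs , refl with xs ↭? (ws ++ zs)
...   | yes p = yes (remove-↭ ws zs p)
...   | no ¬p = no λ q → ¬p (remove-↭⁻ ws zs q)

module Poly {c r} (R : CommutativeSemiring c r) where
  open CommutativeSemiring R

  pow : Carrier → ℕ → Carrier
  pow a zero    = 1#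
  pow a (suc k) = a * pow a k

  sumList : List Carrier → Carrier
  sumList = L.foldr _+_ 0#

  prodFin : ∀ k → (Fin k → Carrier) → Carrier
  prodFin k f = V.foldr _ _*_ 1# (V.tabulate f)

  monomial : ∀ {k} → (Fin k → Carrier) → Vec ℕ k → Carrier
  monomial {k} x α = prodFin k (λ i → pow (x i) (lookup α i))

  -- monomial symmetric polynomial m_μ(x_1,…,x_k) = Σ_{α distinct rearrangement of μ} x^α
  -- (rearrangements have entries ≤ Σ μ, so they all occur in the enumerated box)
  msym : ∀ {k} → (Fin k → Carrier) → Vec ℕ k → Carrier
  msym {k} x μ =
    sumList (map (monomial x)
      (filter (λ α → toList α ↭? toList μ) (allVecs k (range (suc (V.sum μ))))))

  -- Σ_{(m_{ij}) ∈ K} ∏_{i,j} (x_i y_j)^{m_{ij}}, summing over bikeys b ∈ F(s)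
  -- (b ↦ matrixOf b is a bijection from bikeys in F(s) onto K)
  bikeyGF : (n ℓ s : ℕ) → (Fin n → Carrier) → (Fin ℓ → Carrier) → Carrier
  bikeyGF n ℓ s x y =
    sumList (map (λ b → prodFin n (λ i → prodFin ℓ (λ j →
                    if matrixOf b i j then x i * y j else 1#)))
      (filter (IsBikey? s) (allTensors n ℓ)))

  partitionGF : (n ℓ s : ℕ) → (Fin n → Carrier) → (Fin ℓ → Carrier) → Carrier
  partitionGF n ℓ s x y =
    sumList (map (λ λp → msym x λp * msym y (conj ℓ λp)) (partitions n ℓ s))

module Submission where

-- In a bikey the columns form a chain, so row i lies in exactly the r_i largest columns, where r_i is
-- the i-th row sum: with the columns ranked by decreasing size (ties broken by index), M_{ij} = 1 iff
-- rank(j) < r_i.  Sorting the rows by r_i as well turns M into M_λ, λ being the sorted row sums, and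
-- λ^tr is then the sorted column sums; conversely each P_w M_λ P_ẇ with λ ∈ 𝒮(s) is the matrix of a
-- bikey.  So a bikey is determined by its row and column sums, and b ↦ (row sums, column sums) is a
-- bijection from the bikeys in F(s) onto the pairs (α, β) with α a rearrangement of some λ ∈ 𝒮(s) and
-- β a rearrangement of λ^tr.  The weight of b is x^α y^β, which gives the generating function.

open import Defs
open import Level using (Level)
open import Data.Nat using (ℕ; _≤_)
open import Data.Fin using (Fin)
open import Data.Product using (_×_)
open import Function.Bundles using (_⇔_)
open import Algebra.Bundles using (CommutativeSemiring)

open import Algebra.Properties.CommutativeMonoid.Sum as CommutativeMonoidSum using ()
open import Data.Bool using (Bool; true; false; T; if_then_else_)
open import Data.Bool.Properties as Bool using (T-≡)
open import Data.Empty using (⊥-elim)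
open import Data.Fin as Fin using (zero; suc; toℕ; fromℕ<; punchOut)
open import Data.Fin.Properties as Fin using (any?; injective⇒≤; punchOut-injective; toℕ-fromℕ<; toℕ<n)
open import Data.Fin.Permutation
  using (Permutation′; _⟨$⟩ʳ_; _⟨$⟩ˡ_; permutation; inverseʳ; inverseˡ; flip)
open import Data.Fin.Subset using (Subset; _⊆_; ∣_∣)
open import Data.List as List using (List; []; _∷_; _++_)
open import Data.List.Membership.Propositional using (_∈_; lose; find)
open import Data.List.Membership.Propositional.Properties
  using (∈-∃++; ∈-map⁺; ∈-map⁻; ∈-concatMap⁺; ∈-concatMap⁻; ∈-filter⁺; ∈-filter⁻; ∈-upTo⁺;
         ∈-cartesianProduct⁺; ∈-cartesianProduct⁻)
open import Data.List.Membership.Propositional.Properties.WithK using (unique∧set⇒bag)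
import Data.List.Properties as List
open import Data.List.Relation.Binary.BagAndSetEquality using (∼bag⇒↭)
import Data.List.Relation.Binary.Permutation.Homogeneous as Homogeneous
open import Data.List.Relation.Binary.Permutation.Propositional
  using (_↭_; ↭-refl; ↭-prep; ↭-trans; ↭-sym; ↭⇒↭ₛ)
import Data.List.Relation.Binary.Permutation.Propositional.Properties as ↭
import Data.List.Relation.Binary.Permutation.Setoid.Properties as SetoidPermutation
open import Data.List.Relation.Unary.All as All using ([]; _∷_)
import Data.List.Relation.Unary.All.Properties as All
open import Data.List.Relation.Unary.AllPairs using ([]; _∷_)
open import Data.List.Relation.Unary.Any using (here; there)
open import Data.List.Relation.Unary.Unique.Propositional using (Unique)
import Data.List.Relation.Unary.Unique.Propositional.Properties as Unique
open import Data.Nat as ℕ using (zero; suc; _<_; _<ᵇ_; _≤ᵇ_; z≤n; s≤s)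
open import Data.Nat.ListAction using (sum)
open import Data.Nat.ListAction.Properties using (sum-↭)
open import Data.Nat.Properties as ℕ
  using (+-0-commutativeMonoid; ≤-refl; ≤-trans; <⇒≤; <⇒≱; ≮⇒≥; +-mono-≤; +-mono-≤-<; +-mono-<-≤;
         <⇒<ᵇ; <ᵇ⇒<; ≤⇒≤ᵇ; ≤ᵇ⇒≤)
open import Data.Product using (∃; _,_; proj₁; proj₂; uncurry)
open import Data.Sum using (_⊎_; inj₁; inj₂)
open import Data.Vec as Vec using (Vec; []; _∷_; lookup; tabulate; toList)
open import Data.Vec.Properties as Vec
  using (lookup∘tabulate; tabulate∘lookup; tabulate-cong; []=⇒lookup; lookup⇒[]=)
open import Function.Base using (_∘_)
open import Function.Bundles using (mk⇔; Equivalence)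
open import Function.Definitions using (Injective)
open import Relation.Binary.Definitions using (tri<; tri≈; tri>)
open import Relation.Binary.PropositionalEquality
open import Relation.Nullary using (¬_; Dec; yes; no; does; contradiction)
open import Relation.Nullary.Decidable using (T?; decidable-stable; _⊎-dec_; _×-dec_)
open import Relation.Unary using (Pred; Decidable)

module ℕΣ = CommutativeMonoidSum +-0-commutativeMonoid
open ℕΣ using () renaming (sum to ∑)

T-extensional : ∀ {a b} → (T a → T b) → (T b → T a) → a ≡ b
T-extensional {false} {false} _   _   = refl
T-extensional {false} {true}  _   b⇒a = ⊥-elim (b⇒a _)
T-extensional {true}  {false} a⇒b _   = ⊥-elim (a⇒b _)
T-extensional {true}  {true}  _   _   = refl

does-sound : ∀ {a} {A : Set a} (A? : Dec A) → T (does A?) → A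
does-sound (yes a) _ = a

does-complete : ∀ {a} {A : Set a} (A? : Dec A) → A → T (does A?)
does-complete (yes _)  _ = _
does-complete (no ¬a) a = ¬a a

indicator : Bool → ℕ
indicator b = if b then 1 else 0

count : ∀ {m} → (Fin m → Bool) → ℕ
count P = ∑ (indicator ∘ P)

∑-mono : ∀ {m} {f g : Fin m → ℕ} → (∀ i → f i ≤ g i) → ∑ f ≤ ∑ g
∑-mono {zero}  f≤g = z≤n
∑-mono {suc m} f≤g = +-mono-≤ (f≤g zero) (∑-mono (f≤g ∘ suc))

∑-term : ∀ {m} (f : Fin m → ℕ) i → f i ≤ ∑ f
∑-term f zero    = ℕ.m≤m+n _ _
∑-term f (suc i) = ≤-trans (∑-term (f ∘ suc) i) (ℕ.m≤n+m _ _)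

vecSum≡∑ : ∀ {m} (v : Vec ℕ m) → Vec.sum v ≡ ∑ (lookup v)
vecSum≡∑ []      = refl
vecSum≡∑ (x ∷ v) = cong (x ℕ.+_) (vecSum≡∑ v)

indicator-mono : ∀ {a b} → (T a → T b) → indicator a ≤ indicator b
indicator-mono {false}         _   = z≤n
indicator-mono {true}  {true}  _   = ≤-refl
indicator-mono {true}  {false} a⇒b = ⊥-elim (a⇒b _)

indicator-< : ∀ {a b} → ¬ T a → T b → indicator a < indicator b
indicator-< {false} {true} _  _ = ℕ.z<s
indicator-< {true}         ¬a _ = ⊥-elim (¬a _)

count-cong : ∀ {m} {P Q : Fin m → Bool} → (∀ i → P i ≡ Q i) → count P ≡ count Q
count-cong P≗Q = ℕΣ.sum-cong-≗ (cong indicator ∘ P≗Q)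

count-mono : ∀ {m} {P Q : Fin m → Bool} → (∀ i → T (P i) → T (Q i)) → count P ≤ count Q
count-mono P⇒Q = ∑-mono (indicator-mono ∘ P⇒Q)

count-< : ∀ {m} {P Q : Fin m → Bool} → (∀ i → T (P i) → T (Q i)) →
          ∀ i → ¬ T (P i) → T (Q i) → count P < count Q
count-< P⇒Q zero    ¬Pi Qi = +-mono-<-≤ (indicator-< ¬Pi Qi) (count-mono (P⇒Q ∘ suc))
count-< P⇒Q (suc i) ¬Pi Qi = +-mono-≤-< (indicator-mono (P⇒Q zero)) (count-< (P⇒Q ∘ suc) i ¬Pi Qi)

count-true : ∀ {m} → count {m} (λ _ → true) ≡ m
count-true {zero}  = refl
count-true {suc m} = cong suc count-true

count≤size : ∀ {m} (P : Fin m → Bool) → count P ≤ m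
count≤size P = subst (count P ≤_) count-true (count-mono {P = P} {Q = λ _ → true} _)

count<size : ∀ {m} (P : Fin m → Bool) i → ¬ T (P i) → count P < m
count<size P i ¬Pi = subst (count P <_) count-true (count-< {P = P} {Q = λ _ → true} _ i ¬Pi _)

count-permute : ∀ {m} (P : Fin m → Bool) (π : Permutation′ m) → count (P ∘ (π ⟨$⟩ʳ_)) ≡ count P
count-permute P π = sym (ℕΣ.sum-permute (indicator ∘ P) π)

count-toℕ<ᵇ : ∀ {m} a → a ≤ m → count {m} (λ q → toℕ q <ᵇ a) ≡ a
count-toℕ<ᵇ {zero}  zero    _         = refl
count-toℕ<ᵇ {suc m} zero    _         = count-toℕ<ᵇ {m} zero z≤n
count-toℕ<ᵇ {suc m} (suc a) (s≤s a≤m) = cong suc (count-toℕ<ᵇ a a≤m)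

vecCount≡count : ∀ {a p} {A : Set a} {P : Pred A p} (P? : Decidable P) {m} (v : Vec A m) →
  Vec.count P? v ≡ count (λ i → does (P? (lookup v i)))
vecCount≡count P? []      = refl
vecCount≡count P? (x ∷ v) with does (P? x)
... | true  = cong suc (vecCount≡count P? v)
... | false = vecCount≡count P? v

-- Sorting by ranks

injective⇒surjective : ∀ {m} (g : Fin m → Fin m) → Injective _≡_ _≡_ g → ∀ p → ∃ λ i → g i ≡ p
injective⇒surjective {suc m} g g-inj p with any? (λ i → g i Fin.≟ p)
... | yes hit  = hit
... | no  miss = contradiction (injective⇒≤ punched-injective) ℕ.1+n≰n
  where
  avoids : ∀ i → p ≢ g i
  avoids i p≡gi = miss (i , sym p≡gi)
  punched-injective : Injective _≡_ _≡_ (λ i → punchOut (avoids i))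
  punched-injective eq = g-inj (punchOut-injective (avoids _) (avoids _) eq)

injective⇒permutation : ∀ {m} (g : Fin m → Fin m) → Injective _≡_ _≡_ g → Permutation′ m
injective⇒permutation g g-inj =
  permutation g (proj₁ ∘ surj) (proj₂ ∘ surj) (λ i → g-inj (proj₂ (surj (g i))))
  where surj = injective⇒surjective g g-inj

Decreasing : ∀ {m} → (Fin m → ℕ) → Set
Decreasing μ = ∀ p p′ → toℕ p ≤ toℕ p′ → μ p′ ≤ μ p

module Ranking {m} (f : Fin m → ℕ) where

  infix 4 _≺_ _≺?_

  _≺_ : Fin m → Fin m → Set
  i ≺ j = f j < f i ⊎ (f i ≡ f j × i Fin.< j)

  _≺?_ : ∀ i j → Dec (i ≺ j)
  i ≺? j = f j ℕ.<? f i ⊎-dec (f i ℕ.≟ f j ×-dec i Fin.<? j)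

  ≺-sound : ∀ {i j} → T (does (i ≺? j)) → i ≺ j
  ≺-sound {i} {j} = does-sound (i ≺? j)

  ≺-complete : ∀ {i j} → i ≺ j → T (does (i ≺? j))
  ≺-complete {i} {j} = does-complete (i ≺? j)

  ≺-irrefl : ∀ {i} → ¬ i ≺ i
  ≺-irrefl (inj₁ fi<fi)     = ℕ.<-irrefl refl fi<fi
  ≺-irrefl (inj₂ (_ , i<i)) = Fin.<-irrefl refl i<i

  ≺-trans : ∀ {i j k} → i ≺ j → j ≺ k → i ≺ k
  ≺-trans         (inj₁ fj<fi)         (inj₁ fk<fj)         = inj₁ (ℕ.<-trans fk<fj fj<fi)
  ≺-trans {i}     (inj₁ fj<fi)         (inj₂ (fj≡fk , _))   = inj₁ (subst (_< f i) fj≡fk fj<fi)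
  ≺-trans {k = k} (inj₂ (fi≡fj , _))   (inj₁ fk<fj)         = inj₁ (subst (f k <_) (sym fi≡fj) fk<fj)
  ≺-trans         (inj₂ (fi≡fj , i<j)) (inj₂ (fj≡fk , j<k)) = inj₂ (trans fi≡fj fj≡fk , Fin.<-trans i<j j<k)

  ≺-connex : ∀ {i j} → i ≢ j → i ≺ j ⊎ j ≺ i
  ≺-connex {i} {j} i≢j with ℕ.<-cmp (f i) (f j) | Fin.<-cmp i j
  ... | tri< fi<fj _ _ | _            = inj₂ (inj₁ fi<fj)
  ... | tri> _ _ fj<fi | _            = inj₁ (inj₁ fj<fi)
  ... | tri≈ _ fi≡fj _ | tri< i<j _ _ = inj₁ (inj₂ (fi≡fj , i<j))
  ... | tri≈ _ _ _     | tri≈ _ i≡j _ = contradiction i≡j i≢j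
  ... | tri≈ _ fi≡fj _ | tri> _ _ j<i = inj₂ (inj₂ (sym fi≡fj , j<i))

  ≺⇒≥ : ∀ {i j} → i ≺ j → f j ≤ f i
  ≺⇒≥ (inj₁ fj<fi)       = <⇒≤ fj<fi
  ≺⇒≥ (inj₂ (fi≡fj , _)) = ℕ.≤-reflexive (sym fi≡fj)

  rank : Fin m → ℕ
  rank j = count (λ i → does (i ≺? j))

  ≺⇒rank< : ∀ {i j} → i ≺ j → rank i < rank j
  ≺⇒rank< {i} i≺j =
    count-< (λ k k≺i → ≺-complete (≺-trans (≺-sound k≺i) i≺j)) i (≺-irrefl ∘ ≺-sound) (≺-complete i≺j)

  rank<m : ∀ j → rank j < m
  rank<m j = count<size _ j (≺-irrefl ∘ ≺-sound)

  rank-injective : Injective _≡_ _≡_ rank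
  rank-injective {i} {j} eq with i Fin.≟ j
  ... | yes i≡j = i≡j
  ... | no  i≢j with ≺-connex i≢j
  ...   | inj₁ i≺j = contradiction eq (ℕ.<⇒≢ (≺⇒rank< i≺j))
  ...   | inj₂ j≺i = contradiction (sym eq) (ℕ.<⇒≢ (≺⇒rank< j≺i))

  rankFin : Fin m → Fin m
  rankFin j = fromℕ< (rank<m j)

  toℕ-rankFin : ∀ j → toℕ (rankFin j) ≡ rank j
  toℕ-rankFin j = toℕ-fromℕ< (rank<m j)

  rankPerm : Permutation′ m
  rankPerm = injective⇒permutation rankFin λ {i} {j} eq →
    rank-injective (trans (sym (toℕ-rankFin i)) (trans (cong toℕ eq) (toℕ-rankFin j)))

  sorted-decreasing : Decreasing (f ∘ (rankPerm ⟨$⟩ˡ_))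
  sorted-decreasing p p′ p≤p′ = ≮⇒≥ λ fp<fp′ →
    <⇒≱ (≺⇒rank< (inj₁ fp<fp′)) (subst₂ _≤_ (toℕ≡rank p) (toℕ≡rank p′) p≤p′)
    where
    toℕ≡rank : ∀ q → toℕ q ≡ rank (rankPerm ⟨$⟩ˡ q)
    toℕ≡rank q = trans (cong toℕ (sym (inverseʳ rankPerm))) (toℕ-rankFin _)

module _ {m} {f g : Fin m → ℕ} (f≗g : ∀ i → f i ≡ g i) where

  private
    module F = Ranking f
    module G = Ranking g

  ≺-transport : ∀ {i j} → i F.≺ j → i G.≺ j
  ≺-transport {i} {j} (inj₁ fj<fi)         = inj₁ (subst₂ _<_ (f≗g j) (f≗g i) fj<fi)
  ≺-transport {i} {j} (inj₂ (fi≡fj , i<j)) = inj₂ (trans (sym (f≗g i)) (trans fi≡fj (f≗g j)) , i<j)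

rank-cong : ∀ {m} {f g : Fin m → ℕ} → (∀ i → f i ≡ g i) → ∀ j → Ranking.rank f j ≡ Ranking.rank g j
rank-cong {f = f} {g} f≗g j = count-cong λ i →
  T-extensional (G.≺-complete ∘ ≺-transport f≗g ∘ F.≺-sound {i} {j})
                (F.≺-complete ∘ ≺-transport (sym ∘ f≗g) ∘ G.≺-sound {i} {j})
  where
  module F = Ranking f
  module G = Ranking g

-- Multisets of naturals and their threshold counts

atLeast : ℕ → List ℕ → ℕ
atLeast t xs = sum (List.map (indicator ∘ (t ≤ᵇ_)) xs)

↭⇒atLeast≡ : ∀ {xs ys} → xs ↭ ys → ∀ t → atLeast t xs ≡ atLeast t ys
↭⇒atLeast≡ xs↭ys t = sum-↭ (↭.map⁺ (indicator ∘ (t ≤ᵇ_)) xs↭ys)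

atLeast-suc≤ : ∀ x xs → atLeast (suc x) xs ≤ atLeast x xs
atLeast-suc≤ x []       = z≤n
atLeast-suc≤ x (y ∷ xs) = +-mono-≤ (indicator-mono (≤⇒≤ᵇ ∘ <⇒≤ ∘ <ᵇ⇒< x y)) (atLeast-suc≤ x xs)

atLeast-suc< : ∀ x xs → atLeast (suc x) (x ∷ xs) < atLeast x (x ∷ xs)
atLeast-suc< x xs =
  +-mono-<-≤ (indicator-< (ℕ.<-irrefl refl ∘ <ᵇ⇒< x x) (≤⇒≤ᵇ (≤-refl {x}))) (atLeast-suc≤ x xs)

atLeast-suc<⇒∈ : ∀ x ys → atLeast (suc x) ys < atLeast x ys → x ∈ ys
atLeast-suc<⇒∈ x (y ∷ ys) lt with y ℕ.≟ x
... | yes refl = here refl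
... | no  y≢x  = there (atLeast-suc<⇒∈ x ys (ℕ.+-cancelˡ-< (indicator (x ≤ᵇ y)) _ _ lt′))
  where
  x<ᵇy≡x≤ᵇy : (x <ᵇ y) ≡ (x ≤ᵇ y)
  x<ᵇy≡x≤ᵇy = T-extensional (≤⇒≤ᵇ ∘ <⇒≤ ∘ <ᵇ⇒< x y)
    (λ x≤y → <⇒<ᵇ (ℕ.≤∧≢⇒< (≤ᵇ⇒≤ x y x≤y) (y≢x ∘ sym)))
  lt′ : indicator (x ≤ᵇ y) ℕ.+ atLeast (suc x) ys < indicator (x ≤ᵇ y) ℕ.+ atLeast x ys
  lt′ = subst (λ b → indicator b ℕ.+ atLeast (suc x) ys < indicator (x ≤ᵇ y) ℕ.+ atLeast x ys) x<ᵇy≡x≤ᵇy lt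

atLeast≡⇒↭ : ∀ xs ys → (∀ t → atLeast t xs ≡ atLeast t ys) → xs ↭ ys
atLeast≡⇒↭ []       []       _  = ↭-refl
atLeast≡⇒↭ []       (y ∷ ys) eq = contradiction (eq 0) λ ()
atLeast≡⇒↭ (x ∷ xs) ys       eq
  with ws , zs , refl ← ∈-∃++ (atLeast-suc<⇒∈ x ys (subst₂ _<_ (eq (suc x)) (eq x) (atLeast-suc< x xs)))
  = ↭-trans (↭-prep x (atLeast≡⇒↭ xs (ws ++ zs) eq′)) (↭-sym (↭.shift x ws zs))
  where
  eq′ : ∀ t → atLeast t xs ≡ atLeast t (ws ++ zs)
  eq′ t = ℕ.+-cancelˡ-≡ (indicator (t ≤ᵇ x)) _ _ (trans (eq t) (↭⇒atLeast≡ (↭.shift x ws zs) t))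

atLeast-toList : ∀ {m} t (v : Vec ℕ m) → atLeast t (toList v) ≡ count (λ i → t ≤ᵇ lookup v i)
atLeast-toList t []      = refl
atLeast-toList t (x ∷ v) = cong (indicator (t ≤ᵇ x) ℕ.+_) (atLeast-toList t v)

↭⇒count≡ : ∀ {m} {v u : Vec ℕ m} → toList v ↭ toList u →
  ∀ t → count (λ i → t ≤ᵇ lookup v i) ≡ count (λ i → t ≤ᵇ lookup u i)
↭⇒count≡ {v = v} {u} v↭u t =
  trans (sym (atLeast-toList t v)) (trans (↭⇒atLeast≡ v↭u t) (atLeast-toList t u))

permute-↭ : ∀ {m} (v u : Vec ℕ m) (π : Permutation′ m) →
  (∀ i → lookup v i ≡ lookup u (π ⟨$⟩ʳ i)) → toList v ↭ toList u
permute-↭ v u π v≗u∘π = atLeast≡⇒↭ (toList v) (toList u) λ t → begin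
  atLeast t (toList v)                   ≡⟨ atLeast-toList t v ⟩
  count (λ i → t ≤ᵇ lookup v i)          ≡⟨ count-cong (cong (t ≤ᵇ_) ∘ v≗u∘π) ⟩
  count (λ i → t ≤ᵇ lookup u (π ⟨$⟩ʳ i)) ≡⟨ count-permute (λ p → t ≤ᵇ lookup u p) π ⟩
  count (λ p → t ≤ᵇ lookup u p)          ≡⟨ atLeast-toList t u ⟨
  atLeast t (toList u)                   ∎
  where open ≡-Reasoning

module _ {m} {μ : Fin m → ℕ} (μ↓ : Decreasing μ) where

  decreasing-≤⇒< : ∀ {t} p → t ≤ μ p → toℕ p < count (λ q → t ≤ᵇ μ q)
  decreasing-≤⇒< p t≤μp = subst (_≤ _) (count-toℕ<ᵇ (suc (toℕ p)) (toℕ<n p))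
    (count-mono λ q q≤p → ≤⇒≤ᵇ (≤-trans t≤μp (μ↓ q p (ℕ.≤-pred (<ᵇ⇒< _ _ q≤p)))))

  decreasing-<⇒≤ : ∀ {t} p → toℕ p < count (λ q → t ≤ᵇ μ q) → t ≤ μ p
  decreasing-<⇒≤ {t} p p<count = ≮⇒≥ λ μp<t → <⇒≱ p<count
    (subst (_ ≤_) (count-toℕ<ᵇ (toℕ p) (<⇒≤ (toℕ<n p)))
      (count-mono λ q t≤μq → <⇒<ᵇ (ℕ.≰⇒> λ p≤q → <⇒≱ μp<t (≤-trans (≤ᵇ⇒≤ t (μ q) t≤μq) (μ↓ p q p≤q)))))

decreasing-≤ : ∀ {m} {μ ν : Fin m → ℕ} → Decreasing μ → Decreasing ν →
  (∀ t → count (λ p → t ≤ᵇ μ p) ≡ count (λ p → t ≤ᵇ ν p)) → ∀ p → μ p ≤ ν p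
decreasing-≤ {μ = μ} μ↓ ν↓ same p =
  decreasing-<⇒≤ ν↓ p (subst (toℕ p <_) (same (μ p)) (decreasing-≤⇒< μ↓ p ≤-refl))

decreasing-unique : ∀ {m} {μ ν : Fin m → ℕ} → Decreasing μ → Decreasing ν →
  (∀ t → count (λ p → t ≤ᵇ μ p) ≡ count (λ p → t ≤ᵇ ν p)) → ∀ p → μ p ≡ ν p
decreasing-unique μ↓ ν↓ same p =
  ℕ.≤-antisym (decreasing-≤ μ↓ ν↓ same p) (decreasing-≤ ν↓ μ↓ (sym ∘ same) p)

lookup-extensional : ∀ {a} {A : Set a} {m} {v u : Vec A m} → (∀ i → lookup v i ≡ lookup u i) → v ≡ u
lookup-extensional {v = v} {u} v≗u =
  trans (sym (tabulate∘lookup v)) (trans (tabulate-cong v≗u) (tabulate∘lookup u))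

tabulate-injective : ∀ {a} {A : Set a} {m} {f g : Fin m → A} → tabulate f ≡ tabulate g → ∀ i → f i ≡ g i
tabulate-injective {f = f} {g} eq i =
  trans (sym (lookup∘tabulate f i)) (trans (cong (λ v → lookup v i) eq) (lookup∘tabulate g i))

↭-decreasing⇒≡ : ∀ {m} {v u : Vec ℕ m} → Decreasing (lookup v) → Decreasing (lookup u) →
  toList v ↭ toList u → v ≡ u
↭-decreasing⇒≡ v↓ u↓ v↭u = lookup-extensional (decreasing-unique v↓ u↓ (↭⇒count≡ v↭u))

↭-decreasing⇒ranked : ∀ {m} {v u : Vec ℕ m} → Decreasing (lookup u) → toList v ↭ toList u →
  ∀ i → lookup v i ≡ lookup u (Ranking.rankFin (lookup v) i)
↭-decreasing⇒ranked {v = v} {u} u↓ v↭u i = begin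
  lookup v i          ≡⟨ cong (lookup v) (inverseˡ ρ) ⟨
  sorted (ρ ⟨$⟩ʳ i)   ≡⟨ decreasing-unique sorted-decreasing u↓ same-counts (ρ ⟨$⟩ʳ i) ⟩
  lookup u (ρ ⟨$⟩ʳ i) ∎
  where
  open ≡-Reasoning
  open Ranking (lookup v) using (sorted-decreasing) renaming (rankPerm to ρ)
  sorted = lookup v ∘ (ρ ⟨$⟩ˡ_)
  same-counts : ∀ t → count (λ p → t ≤ᵇ sorted p) ≡ count (λ p → t ≤ᵇ lookup u p)
  same-counts t = trans (count-permute (λ i → t ≤ᵇ lookup v i) (flip ρ)) (↭⇒count≡ v↭u t)

-- Row and column sums of tensors

∣∣≡count : ∀ {m} (c : Subset m) → ∣ c ∣ ≡ count (lookup c)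
∣∣≡count c = trans (vecCount≡count (Bool._≟ true) c) (count-cong (does-≟-true ∘ lookup c))
  where
  does-≟-true : ∀ b → does (b Bool.≟ true) ≡ b
  does-≟-true true  = refl
  does-≟-true false = refl

⊆⇒T : ∀ {m} {c c′ : Subset m} → c ⊆ c′ → ∀ i → T (lookup c i) → T (lookup c′ i)
⊆⇒T {c = c} c⊆c′ i = Equivalence.from T-≡ ∘ []=⇒lookup ∘ c⊆c′ ∘ lookup⇒[]= i c ∘ Equivalence.to T-≡

T⇒⊆ : ∀ {m} {c c′ : Subset m} → (∀ i → T (lookup c i) → T (lookup c′ i)) → c ⊆ c′
T⇒⊆ {c′ = c′} c⇒c′ {i} = lookup⇒[]= i c′ ∘ Equivalence.to T-≡ ∘ c⇒c′ i ∘ Equivalence.from T-≡ ∘ []=⇒lookup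

module _ {n ℓ} (b : Tensor n ℓ) where

  rowSum : Fin n → ℕ
  rowSum i = count (matrixOf b i)

  columnSum : Fin ℓ → ℕ
  columnSum j = count (λ i → matrixOf b i j)

  size≡∑columnSum : size b ≡ ∑ columnSum
  size≡∑columnSum = go b
    where
    go : ∀ {ℓ} (b : Tensor n ℓ) → size b ≡ ∑ (λ j → count (lookup (lookup b j)))
    go []      = refl
    go (c ∷ b) = cong₂ ℕ._+_ (∣∣≡count c) (go b)

  ∑rowSum≡∑columnSum : ∑ rowSum ≡ ∑ columnSum
  ∑rowSum≡∑columnSum = ℕΣ.∑-comm (λ i j → indicator (matrixOf b i j))

module Chain {n ℓ} (b : Tensor n ℓ) (chain : ColumnsChain b) where

  open Ranking (columnSum b)

  private
    M = matrixOf b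

  ∈-larger-column : ∀ {i} j j′ → T (M i j) → columnSum b j ≤ columnSum b j′ → T (M i j′)
  ∈-larger-column {i} j j′ i∈cj kj≤kj′ with chain j j′
  ... | inj₁ cj⊆cj′ = ⊆⇒T cj⊆cj′ i i∈cj
  ... | inj₂ cj′⊆cj = decidable-stable (T? (M i j′)) λ i∉cj′ →
    <⇒≱ (count-< (⊆⇒T cj′⊆cj) i i∉cj′ i∈cj) kj≤kj′

  ∉∈⇒smaller-column : ∀ {i} j j′ → ¬ T (M i j) → T (M i j′) → columnSum b j < columnSum b j′
  ∉∈⇒smaller-column {i} j j′ i∉cj i∈cj′ with chain j j′
  ... | inj₁ cj⊆cj′ = count-< (⊆⇒T cj⊆cj′) i i∉cj i∈cj′
  ... | inj₂ cj′⊆cj = contradiction (⊆⇒T cj′⊆cj i i∈cj′) i∉cj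

  entry≡rank<rowSum : ∀ i j → M i j ≡ (rank j <ᵇ rowSum b i)
  entry≡rank<rowSum i j = T-extensional (<⇒<ᵇ ∘ rank<rowSum) λ rank<rowSumᵇ →
    decidable-stable (T? (M i j)) λ i∉cj → <⇒≱ (<ᵇ⇒< _ _ rank<rowSumᵇ) (rowSum≤rank i∉cj)
    where
    rank<rowSum : T (M i j) → rank j < rowSum b i
    rank<rowSum i∈cj = count-< (λ j′ j′≺j → ∈-larger-column j j′ i∈cj (≺⇒≥ (≺-sound j′≺j)))
      j (≺-irrefl ∘ ≺-sound) i∈cj
    rowSum≤rank : ¬ T (M i j) → rowSum b i ≤ rank j
    rowSum≤rank i∉cj = count-mono λ j′ i∈cj′ → ≺-complete (inj₁ (∉∈⇒smaller-column j j′ i∉cj i∈cj′))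

-- Placed partitions P_w M_λ P_ẇ

lookup-conj : ∀ {n} ℓ (λp : Vec ℕ n) q → lookup (conj ℓ λp) q ≡ count (λ p → toℕ q <ᵇ lookup λp p)
lookup-conj ℓ λp q = trans (lookup∘tabulate _ q) (vecCount≡count (λ v → suc (toℕ q) ℕ.≤? v) λp)

conj-decreasing : ∀ {n} ℓ (λp : Vec ℕ n) → Decreasing (lookup (conj ℓ λp))
conj-decreasing ℓ λp q q′ q≤q′ = subst₂ _≤_ (sym (lookup-conj ℓ λp q′)) (sym (lookup-conj ℓ λp q))
  (count-mono {P = λ p → toℕ q′ <ᵇ lookup λp p} λ p q′<λp →
    <⇒<ᵇ (ℕ.≤-<-trans q≤q′ (<ᵇ⇒< (toℕ q′) (lookup λp p) q′<λp)))

∑-conj : ∀ {n} ℓ (λp : Vec ℕ n) → (∀ p → lookup λp p ≤ ℓ) → ∑ (lookup (conj ℓ λp)) ≡ Vec.sum λp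
∑-conj {n} ℓ λp λp≤ℓ = begin
  ∑ (lookup (conj ℓ λp))
    ≡⟨ ℕΣ.sum-cong-≗ (lookup-conj ℓ λp) ⟩
  ∑ (λ (q : Fin ℓ) → count (λ p → toℕ q <ᵇ lookup λp p))
    ≡⟨ ℕΣ.∑-comm {n} {ℓ} (λ p q → indicator (toℕ q <ᵇ lookup λp p)) ⟨
  ∑ (λ p → count {ℓ} (λ q → toℕ q <ᵇ lookup λp p))
    ≡⟨ ℕΣ.sum-cong-≗ (λ p → count-toℕ<ᵇ (lookup λp p) (λp≤ℓ p)) ⟩
  ∑ (lookup λp)
    ≡⟨ vecSum≡∑ λp ⟨
  Vec.sum λp
    ∎
  where open ≡-Reasoning

module Placed {n ℓ} (λp : Vec ℕ n) (w : Permutation′ n) (ẇ : Permutation′ ℓ) where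

  M : BinMat n ℓ
  M = permMat w (Mλ λp) ẇ

  tensor : Tensor n ℓ
  tensor = tabulate (λ j → tabulate (λ i → M i j))

  matrixOf-tensor : ∀ i j → matrixOf tensor i j ≡ M i j
  matrixOf-tensor i j = trans (cong (λ c → lookup c i) (lookup∘tabulate _ j)) (lookup∘tabulate _ i)

  columnCount : ∀ j → count (λ i → M i j) ≡ lookup (conj ℓ λp) (ẇ ⟨$⟩ʳ j)
  columnCount j = trans (count-permute (λ p → toℕ (ẇ ⟨$⟩ʳ j) <ᵇ lookup λp p) (flip w))
                        (sym (lookup-conj ℓ λp (ẇ ⟨$⟩ʳ j)))

  rowSum-tensor : (∀ p → lookup λp p ≤ ℓ) → ∀ i → rowSum tensor i ≡ lookup λp (w ⟨$⟩ˡ i)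
  rowSum-tensor λp≤ℓ i = trans (count-cong (matrixOf-tensor i))
    (trans (count-permute (λ q → toℕ q <ᵇ lookup λp (w ⟨$⟩ˡ i)) ẇ) (count-toℕ<ᵇ _ (λp≤ℓ _)))

  columnSum-tensor : ∀ j → columnSum tensor j ≡ lookup (conj ℓ λp) (ẇ ⟨$⟩ʳ j)
  columnSum-tensor j = trans (count-cong (λ i → matrixOf-tensor i j)) (columnCount j)

  size-tensor : (∀ p → lookup λp p ≤ ℓ) → size tensor ≡ Vec.sum λp
  size-tensor λp≤ℓ = begin
    size tensor                        ≡⟨ size≡∑columnSum tensor ⟩
    ∑ (columnSum tensor)               ≡⟨ ℕΣ.sum-cong-≗ columnSum-tensor ⟩
    ∑ (lookup (conj ℓ λp) ∘ (ẇ ⟨$⟩ʳ_)) ≡⟨ ℕΣ.sum-permute (lookup (conj ℓ λp)) ẇ ⟨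
    ∑ (lookup (conj ℓ λp))             ≡⟨ ∑-conj ℓ λp λp≤ℓ ⟩
    Vec.sum λp                         ∎
    where open ≡-Reasoning

  column-⊆ : ∀ {j j′} → toℕ (ẇ ⟨$⟩ʳ j) ≤ toℕ (ẇ ⟨$⟩ʳ j′) → lookup tensor j′ ⊆ lookup tensor j
  column-⊆ {j} {j′} q≤q′ = T⇒⊆ λ i i∈cj′ → subst T (sym (matrixOf-tensor i j))
    (<⇒<ᵇ (ℕ.≤-<-trans q≤q′ (<ᵇ⇒< _ (lookup λp (w ⟨$⟩ˡ i)) (subst T (matrixOf-tensor i j′) i∈cj′))))

  tensor-chain : ColumnsChain tensor
  tensor-chain j j′ with ℕ.≤-total (toℕ (ẇ ⟨$⟩ʳ j)) (toℕ (ẇ ⟨$⟩ʳ j′))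
  ... | inj₁ q≤q′ = inj₂ (column-⊆ q≤q′)
  ... | inj₂ q′≤q = inj₁ (column-⊆ q′≤q)

  tensor-bikey : ∀ {s} → IsPartitionIn n ℓ s λp → IsBikey s tensor
  tensor-bikey (_ , λp≤ℓ , Σλp≡s) = trans (size-tensor λp≤ℓ) Σλp≡s , tensor-chain

module Shape {n ℓ s} (b : Tensor n ℓ) (bikey : IsBikey s b) where

  rowRank : Permutation′ n
  rowRank = Ranking.rankPerm (rowSum b)

  w : Permutation′ n
  w = flip rowRank

  ẇ : Permutation′ ℓ
  ẇ = Ranking.rankPerm (columnSum b)

  shape : Vec ℕ n
  shape = tabulate (rowSum b ∘ (rowRank ⟨$⟩ˡ_))

  lookup-shape : ∀ p → lookup shape p ≡ rowSum b (rowRank ⟨$⟩ˡ p)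
  lookup-shape = lookup∘tabulate _

  rowSum≡shape : ∀ i → rowSum b i ≡ lookup shape (w ⟨$⟩ˡ i)
  rowSum≡shape i = sym (trans (lookup-shape _) (cong (rowSum b) (inverseˡ rowRank)))

  matrix≡placed : ∀ i j → matrixOf b i j ≡ Placed.M shape w ẇ i j
  matrix≡placed i j = trans (Chain.entry≡rank<rowSum b (proj₂ bikey) i j)
    (cong₂ _<ᵇ_ (sym (Ranking.toℕ-rankFin (columnSum b) j)) (rowSum≡shape i))

  columnSum≡conj : ∀ j → columnSum b j ≡ lookup (conj ℓ shape) (ẇ ⟨$⟩ʳ j)
  columnSum≡conj j = trans (count-cong (λ i → matrix≡placed i j)) (Placed.columnCount shape w ẇ j)

  shape-partition : IsPartitionIn n ℓ s shape
  shape-partition = shape-decreasing , shape≤ℓ , Σshape≡s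
    where
    shape-decreasing : Decreasing (lookup shape)
    shape-decreasing p p′ p≤p′ = subst₂ _≤_ (sym (lookup-shape p′)) (sym (lookup-shape p))
      (Ranking.sorted-decreasing (rowSum b) p p′ p≤p′)
    shape≤ℓ : ∀ p → lookup shape p ≤ ℓ
    shape≤ℓ p = subst (_≤ ℓ) (sym (lookup-shape p)) (count≤size _)
    Σshape≡s : Vec.sum shape ≡ s
    Σshape≡s = begin
      Vec.sum shape                  ≡⟨ vecSum≡∑ shape ⟩
      ∑ (lookup shape)               ≡⟨ ℕΣ.sum-cong-≗ lookup-shape ⟩
      ∑ (rowSum b ∘ (rowRank ⟨$⟩ˡ_)) ≡⟨ ℕΣ.sum-permute (rowSum b) w ⟨
      ∑ (rowSum b)                   ≡⟨ ∑rowSum≡∑columnSum b ⟩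
      ∑ (columnSum b)                ≡⟨ size≡∑columnSum b ⟨
      size b                         ≡⟨ proj₁ bikey ⟩
      s                              ∎
      where open ≡-Reasoning

bikeyMatrix⇔placedPartition : ∀ {n ℓ} s (M : BinMat n ℓ) → InK s M ⇔ InUnion s M
bikeyMatrix⇔placedPartition s M = mk⇔ to from
  where
  to : InK s M → InUnion s M
  to (b , bikey , M≗b) = shape , shape-partition , w , ẇ , λ i j → trans (M≗b i j) (matrix≡placed i j)
    where open Shape b bikey
  from : InUnion s M → InK s M
  from (λp , λp-partition , w , ẇ , M≗placed) =
    tensor , tensor-bikey λp-partition , λ i j → trans (M≗placed i j) (sym (matrixOf-tensor i j))
    where open Placed λp w ẇ

-- Enumerations without repetition

module _ {a b} {A : Set a} {B : Set b} where

  map-unique : ∀ {f : A → B} {xs} → (∀ {x y} → x ∈ xs → y ∈ xs → f x ≡ f y → x ≡ y) →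
    Unique xs → Unique (List.map f xs)
  map-unique f-inj []           = []
  map-unique f-inj (x∉xs ∷ xs!) =
    All.map⁺ (All.tabulate λ y∈xs → All.lookup x∉xs y∈xs ∘ f-inj (here refl) (there y∈xs))
    ∷ map-unique (λ x∈xs y∈xs → f-inj (there x∈xs) (there y∈xs)) xs!

  concatMap-unique : ∀ {f : A → List B} {xs} → Unique xs → (∀ {x} → x ∈ xs → Unique (f x)) →
    (∀ {x y z} → x ∈ xs → y ∈ xs → z ∈ f x → z ∈ f y → x ≡ y) → Unique (List.concatMap f xs)
  concatMap-unique []           _  _         = []
  concatMap-unique {f = f} (x∉xs ∷ xs!) f! overlap⇒≡ =
    Unique.++⁺ (f! (here refl))
      (concatMap-unique xs! (f! ∘ there) λ x∈xs y∈xs → overlap⇒≡ (there x∈xs) (there y∈xs))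
      λ (z∈fx , z∈rest) → let y , y∈xs , z∈fy = find (∈-concatMap⁻ f z∈rest) in
        All.lookup x∉xs y∈xs (overlap⇒≡ (here refl) (there y∈xs) z∈fx z∈fy)

module _ {a} {A : Set a} where

  ∈-allVecs : ∀ {k} {xs : List A} (v : Vec A k) → (∀ i → lookup v i ∈ xs) → v ∈ allVecs k xs
  ∈-allVecs []      _       = here refl
  ∈-allVecs (x ∷ v) entries =
    ∈-concatMap⁺ _ (lose (entries zero) (∈-map⁺ (x ∷_) (∈-allVecs v (entries ∘ suc))))

  allVecs-unique : ∀ k {xs : List A} → Unique xs → Unique (allVecs k xs)
  allVecs-unique zero    _   = [] ∷ []
  allVecs-unique (suc k) xs! = concatMap-unique xs!
    (λ _ → Unique.map⁺ Vec.∷-injectiveʳ (allVecs-unique k xs!))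
    λ _ _ z∈ z∈′ → let _ , _ , z≡ = ∈-map⁻ _ z∈ ; _ , _ , z≡′ = ∈-map⁻ _ z∈′ in
      Vec.∷-injectiveˡ (trans (sym z≡) z≡′)

bikeys : (n ℓ s : ℕ) → List (Tensor n ℓ)
bikeys n ℓ s = List.filter (IsBikey? s) (allTensors n ℓ)

rearrangements : ∀ {k} → Vec ℕ k → List (Vec ℕ k)
rearrangements {k} μ = List.filter (λ α → toList α ↭? toList μ) (allVecs k (range (suc (Vec.sum μ))))

rearrangementPairs : ∀ {n} ℓ → Vec ℕ n → List (Vec ℕ n × Vec ℕ ℓ)
rearrangementPairs ℓ λp = List.cartesianProduct (rearrangements λp) (rearrangements (conj ℓ λp))

exponentPairs : (n ℓ s : ℕ) → List (Vec ℕ n × Vec ℕ ℓ)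
exponentPairs n ℓ s = List.concatMap (rearrangementPairs ℓ) (partitions n ℓ s)

∈-bikeys⁺ : ∀ {n ℓ s} (b : Tensor n ℓ) → IsBikey s b → b ∈ bikeys n ℓ s
∈-bikeys⁺ b =
  ∈-filter⁺ (IsBikey? _) (∈-allVecs b λ j → ∈-allVecs (lookup b j) (bool∈ ∘ lookup (lookup b j)))
  where
  bool∈ : ∀ x → x ∈ true ∷ false ∷ []
  bool∈ true  = here refl
  bool∈ false = there (here refl)

∈-bikeys⁻ : ∀ {n ℓ s} {b : Tensor n ℓ} → b ∈ bikeys n ℓ s → IsBikey s b
∈-bikeys⁻ {n} {ℓ} {s} = proj₂ ∘ ∈-filter⁻ (IsBikey? s) {xs = allTensors n ℓ}

∈-partitions⁺ : ∀ {n ℓ s} {λp : Vec ℕ n} → IsPartitionIn n ℓ s λp → λp ∈ partitions n ℓ s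
∈-partitions⁺ {λp = λp} λp-partition@(_ , λp≤ℓ , _) =
  ∈-filter⁺ (IsPartitionIn? _ _ _) (∈-allVecs λp (λ p → ∈-upTo⁺ (s≤s (λp≤ℓ p)))) λp-partition

∈-partitions⁻ : ∀ {n ℓ s} {λp : Vec ℕ n} → λp ∈ partitions n ℓ s → IsPartitionIn n ℓ s λp
∈-partitions⁻ {n} {ℓ} {s} = proj₂ ∘ ∈-filter⁻ (IsPartitionIn? n ℓ s) {xs = allVecs n (range (suc ℓ))}

permuted∈rearrangements : ∀ {k} {α μ : Vec ℕ k} (π : Permutation′ k) →
  (∀ i → lookup α i ≡ lookup μ (π ⟨$⟩ʳ i)) → α ∈ rearrangements μ
permuted∈rearrangements {α = α} {μ} π α≗μ∘π =
  ∈-filter⁺ (λ α → toList α ↭? toList μ) (∈-allVecs α (λ i → ∈-upTo⁺ (s≤s (α≤Σμ i))))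
    (permute-↭ α μ π α≗μ∘π)
  where
  α≤Σμ : ∀ i → lookup α i ≤ Vec.sum μ
  α≤Σμ i = subst₂ _≤_ (sym (α≗μ∘π i)) (sym (vecSum≡∑ μ)) (∑-term (lookup μ) (π ⟨$⟩ʳ i))

∈-rearrangements⁻ : ∀ {k} {α μ : Vec ℕ k} → α ∈ rearrangements μ → toList α ↭ toList μ
∈-rearrangements⁻ {k} {μ = μ} =
  proj₂ ∘ ∈-filter⁻ (λ α → toList α ↭? toList μ) {xs = allVecs k (range (suc (Vec.sum μ)))}

-- Bikeys correspond to pairs of rearrangements of λ and λ^tr

degrees : ∀ {n ℓ} → Tensor n ℓ → Vec ℕ n × Vec ℕ ℓ
degrees b = tabulate (rowSum b) , tabulate (columnSum b)

module _ {n ℓ s : ℕ} where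

  degrees-injective : ∀ {b b′} → b ∈ bikeys n ℓ s → b′ ∈ bikeys n ℓ s → degrees b ≡ degrees b′ → b ≡ b′
  degrees-injective {b} {b′} b∈ b′∈ same = lookup-extensional λ j → lookup-extensional λ i → begin
    matrixOf b i j                               ≡⟨ Chain.entry≡rank<rowSum b (proj₂ (∈-bikeys⁻ b∈)) i j ⟩
    Ranking.rank (columnSum b) j <ᵇ rowSum b i   ≡⟨ cong₂ _<ᵇ_ (rank-cong same-columns j) (same-rows i) ⟩
    Ranking.rank (columnSum b′) j <ᵇ rowSum b′ i ≡⟨ Chain.entry≡rank<rowSum b′ (proj₂ (∈-bikeys⁻ b′∈)) i j ⟨
    matrixOf b′ i j                              ∎
    where
    open ≡-Reasoning
    same-rows    = tabulate-injective (cong proj₁ same)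
    same-columns = tabulate-injective (cong proj₂ same)

  rearrangementPairs-overlap⇒≡ : ∀ {λp λp′ αβ} → λp ∈ partitions n ℓ s → λp′ ∈ partitions n ℓ s →
    αβ ∈ rearrangementPairs ℓ λp → αβ ∈ rearrangementPairs ℓ λp′ → λp ≡ λp′
  rearrangementPairs-overlap⇒≡ λp∈ λp′∈ αβ∈ αβ∈′ =
    ↭-decreasing⇒≡ (proj₁ (∈-partitions⁻ λp∈)) (proj₁ (∈-partitions⁻ λp′∈))
      (↭-trans (↭-sym (∈-rearrangements⁻ (proj₁ (∈-cartesianProduct⁻ _ _ αβ∈))))
               (∈-rearrangements⁻ (proj₁ (∈-cartesianProduct⁻ _ _ αβ∈′))))

  exponentPairs-unique : Unique (exponentPairs n ℓ s)
  exponentPairs-unique = concatMap-unique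
    (Unique.filter⁺ (IsPartitionIn? n ℓ s) (allVecs-unique n (Unique.upTo⁺ (suc ℓ))))
    (λ _ → Unique.cartesianProduct⁺ (rearrangements-unique _) (rearrangements-unique _))
    rearrangementPairs-overlap⇒≡
    where
    rearrangements-unique : ∀ {k} (μ : Vec ℕ k) → Unique (rearrangements μ)
    rearrangements-unique {k} μ = Unique.filter⁺ _ (allVecs-unique k (Unique.upTo⁺ _))

  bikeys-unique : Unique (bikeys n ℓ s)
  bikeys-unique =
    Unique.filter⁺ (IsBikey? s) (allVecs-unique ℓ (allVecs-unique n (((λ ()) ∷ []) ∷ [] ∷ [])))

  degrees∈exponentPairs : ∀ {b} → b ∈ bikeys n ℓ s → degrees b ∈ exponentPairs n ℓ s
  degrees∈exponentPairs {b} b∈ =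
    ∈-concatMap⁺ (rearrangementPairs ℓ) (lose (∈-partitions⁺ shape-partition) (∈-cartesianProduct⁺
      (permuted∈rearrangements {μ = shape} rowRank λ i → trans (lookup∘tabulate _ i) (rowSum≡shape i))
      (permuted∈rearrangements {μ = conj ℓ shape} ẇ λ j → trans (lookup∘tabulate _ j) (columnSum≡conj j))))
    where open Shape b (∈-bikeys⁻ b∈)

  exponentPair∈degrees : ∀ {αβ} → αβ ∈ exponentPairs n ℓ s → αβ ∈ List.map degrees (bikeys n ℓ s)
  exponentPair∈degrees {α , β} αβ∈
    with λp , λp∈ , αβ∈pairs ← find (∈-concatMap⁻ (rearrangementPairs ℓ) {xs = partitions n ℓ s} αβ∈)
    with α∈ , β∈ ← ∈-cartesianProduct⁻ (rearrangements λp) _ αβ∈pairs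
    = subst (_∈ _) degrees-tensor (∈-map⁺ degrees (∈-bikeys⁺ tensor (tensor-bikey λp-partition)))
    where
    λp-partition = ∈-partitions⁻ λp∈
    open Placed λp (flip (Ranking.rankPerm (lookup α))) (Ranking.rankPerm (lookup β))
    degrees-tensor : degrees tensor ≡ (α , β)
    degrees-tensor = cong₂ _,_
      (lookup-extensional λ i → trans (lookup∘tabulate _ i)
        (trans (rowSum-tensor (proj₁ (proj₂ λp-partition)) i)
               (sym (↭-decreasing⇒ranked (proj₁ λp-partition) (∈-rearrangements⁻ α∈) i))))
      (lookup-extensional λ j → trans (lookup∘tabulate _ j)
        (trans (columnSum-tensor j)
               (sym (↭-decreasing⇒ranked (conj-decreasing ℓ λp) (∈-rearrangements⁻ β∈) j))))

  degrees↭exponentPairs : List.map degrees (bikeys n ℓ s) ↭ exponentPairs n ℓ s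
  degrees↭exponentPairs = ∼bag⇒↭ (unique∧set⇒bag
    (map-unique degrees-injective bikeys-unique) exponentPairs-unique (mk⇔ to exponentPair∈degrees))
    where
    to : ∀ {αβ} → αβ ∈ List.map degrees (bikeys n ℓ s) → αβ ∈ exponentPairs n ℓ s
    to αβ∈ with b , b∈ , refl ← ∈-map⁻ degrees αβ∈ = degrees∈exponentPairs b∈

module Sums {c r} (R : CommutativeSemiring c r) where

  open CommutativeSemiring R hiding (zero) renaming (refl to ≈-refl; sym to ≈-sym; trans to ≈-trans)
  open Poly R
  open import Relation.Binary.Reasoning.Setoid (CommutativeSemiring.setoid R)
  open SetoidPermutation (CommutativeSemiring.setoid R) using (foldr-commMonoid)
  module ∏ = CommutativeMonoidSum *-commutativeMonoid
  open ∏ using () renaming (sum to ∏)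

  prodFin≡∏ : ∀ k (f : Fin k → Carrier) → prodFin k f ≡ ∏ f
  prodFin≡∏ zero    f = refl
  prodFin≡∏ (suc k) f = cong (f zero *_) (prodFin≡∏ k (f ∘ suc))

  ∏-indicator : ∀ {k} (P : Fin k → Bool) a → ∏ (λ j → if P j then a else 1#) ≈ pow a (count P)
  ∏-indicator {zero}  P a = ≈-refl
  ∏-indicator {suc k} P a with P zero
  ... | true  = *-congˡ (∏-indicator (P ∘ suc) a)
  ... | false = ≈-trans (*-identityˡ _) (∏-indicator (P ∘ suc) a)

  monomial-tabulate : ∀ {k} (x : Fin k → Carrier) (e : Fin k → ℕ) →
    monomial x (tabulate e) ≡ ∏ (λ i → pow (x i) (e i))
  monomial-tabulate {k} x e =
    trans (prodFin≡∏ k _) (∏.sum-cong-≗ λ i → cong (pow (x i)) (lookup∘tabulate e i))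

  sumList-map-cong : ∀ {a} {A : Set a} {f g : A → Carrier} → (∀ x → f x ≈ g x) →
    ∀ xs → sumList (List.map f xs) ≈ sumList (List.map g xs)
  sumList-map-cong f≈g []       = ≈-refl
  sumList-map-cong f≈g (x ∷ xs) = +-cong (f≈g x) (sumList-map-cong f≈g xs)

  sumList-++ : ∀ xs ys → sumList (xs ++ ys) ≈ sumList xs + sumList ys
  sumList-++ []       ys = ≈-sym (+-identityˡ _)
  sumList-++ (x ∷ xs) ys = ≈-trans (+-congˡ (sumList-++ xs ys)) (≈-sym (+-assoc _ _ _))

  sumList-↭ : ∀ {xs ys} → xs ↭ ys → sumList xs ≈ sumList ys
  sumList-↭ = foldr-commMonoid +-isCommutativeMonoid ∘ Homogeneous.map reflexive ∘ ↭⇒↭ₛ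

  sumList-concatMap : ∀ {a b} {A : Set a} {B : Set b} (h : B → Carrier) (f : A → List B) xs →
    sumList (List.map h (List.concatMap f xs)) ≈ sumList (List.map (sumList ∘ List.map h ∘ f) xs)
  sumList-concatMap h f []       = ≈-refl
  sumList-concatMap h f (x ∷ xs) = begin
    sumList (List.map h (f x ++ List.concatMap f xs))
      ≡⟨ cong sumList (List.map-++ h (f x) _) ⟩
    sumList (List.map h (f x) ++ List.map h (List.concatMap f xs))
      ≈⟨ sumList-++ (List.map h (f x)) _ ⟩
    sumList (List.map h (f x)) + sumList (List.map h (List.concatMap f xs))
      ≈⟨ +-congˡ (sumList-concatMap h f xs) ⟩
    sumList (List.map h (f x)) + sumList (List.map (sumList ∘ List.map h ∘ f) xs)
      ∎

  *-distribˡ-sumList : ∀ {b} {B : Set b} a (g : B → Carrier) bs →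
    a * sumList (List.map g bs) ≈ sumList (List.map (λ b → a * g b) bs)
  *-distribˡ-sumList a g []       = zeroʳ a
  *-distribˡ-sumList a g (b ∷ bs) = ≈-trans (distribˡ a _ _) (+-congˡ (*-distribˡ-sumList a g bs))

  sumList-cartesianProduct : ∀ {a b} {A : Set a} {B : Set b} (f : A → Carrier) (g : B → Carrier) as bs →
    sumList (List.map f as) * sumList (List.map g bs)
      ≈ sumList (List.map (uncurry λ a b → f a * g b) (List.cartesianProduct as bs))
  sumList-cartesianProduct f g []       bs = zeroˡ _
  sumList-cartesianProduct f g (a ∷ as) bs = begin
    (f a + sumList (List.map f as)) * sumList (List.map g bs)
      ≈⟨ distribʳ _ _ _ ⟩
    f a * sumList (List.map g bs) + sumList (List.map f as) * sumList (List.map g bs)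
      ≈⟨ +-cong (*-distribˡ-sumList (f a) g bs) (sumList-cartesianProduct f g as bs) ⟩
    sumList (List.map (λ b → f a * g b) bs) + sumList (List.map fg (List.cartesianProduct as bs))
      ≡⟨ cong (λ xs → sumList xs + sumList (List.map fg (List.cartesianProduct as bs))) (List.map-∘ bs) ⟩
    sumList (List.map fg (List.map (a ,_) bs)) + sumList (List.map fg (List.cartesianProduct as bs))
      ≈⟨ sumList-++ (List.map fg (List.map (a ,_) bs)) _ ⟨
    sumList (List.map fg (List.map (a ,_) bs) ++ List.map fg (List.cartesianProduct as bs))
      ≡⟨ cong sumList (List.map-++ fg (List.map (a ,_) bs) _) ⟨
    sumList (List.map fg (List.cartesianProduct (a ∷ as) bs))
      ∎
    where
    fg = uncurry λ a b → f a * g b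

  weight : ∀ {n ℓ} → (Fin n → Carrier) → (Fin ℓ → Carrier) → Vec ℕ n × Vec ℕ ℓ → Carrier
  weight x y = uncurry λ α β → monomial x α * monomial y β

  bikeyTerm : ∀ {n ℓ} → (Fin n → Carrier) → (Fin ℓ → Carrier) → Tensor n ℓ → Carrier
  bikeyTerm {n} {ℓ} x y b = prodFin n (λ i → prodFin ℓ (λ j → if matrixOf b i j then x i * y j else 1#))

  bikeyTerm≈weight : ∀ {n ℓ} x y (b : Tensor n ℓ) → bikeyTerm x y b ≈ weight x y (degrees b)
  bikeyTerm≈weight {n} {ℓ} x y b = begin
    bikeyTerm x y b
      ≡⟨ trans (prodFin≡∏ n _) (∏.sum-cong-≗ λ i → prodFin≡∏ ℓ (λ j → if M i j then x i * y j else 1#)) ⟩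
    ∏ (λ i → ∏ (λ j → if M i j then x i * y j else 1#))
      ≈⟨ ∏.sum-cong-≋ (λ i → ∏.sum-cong-≋ λ j → split-if (M i j)) ⟩
    ∏ (λ i → ∏ (λ j → X i j * Y i j))
      ≈⟨ ∏.sum-cong-≋ (λ i → ∏.∑-distrib-+ (X i) (Y i)) ⟩
    ∏ (λ i → ∏ (X i) * ∏ (Y i))
      ≈⟨ ∏.∑-distrib-+ (∏ ∘ X) (∏ ∘ Y) ⟩
    ∏ (λ i → ∏ (X i)) * ∏ (λ i → ∏ (Y i))
      ≈⟨ *-congˡ (∏.∑-comm Y) ⟩
    ∏ (λ i → ∏ (X i)) * ∏ (λ j → ∏ (λ i → Y i j))
      ≈⟨ *-cong (∏.sum-cong-≋ λ i → ∏-indicator (M i) (x i))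
                (∏.sum-cong-≋ λ j → ∏-indicator (λ i → M i j) (y j)) ⟩
    ∏ (λ i → pow (x i) (rowSum b i)) * ∏ (λ j → pow (y j) (columnSum b j))
      ≡⟨ cong₂ _*_ (monomial-tabulate x (rowSum b)) (monomial-tabulate y (columnSum b)) ⟨
    weight x y (degrees b)
      ∎
    where
    M = matrixOf b
    X Y : Fin n → Fin ℓ → Carrier
    X i j = if M i j then x i else 1#
    Y i j = if M i j then y j else 1#
    split-if : ∀ {a a′} m → (if m then a * a′ else 1#) ≈ (if m then a else 1#) * (if m then a′ else 1#)
    split-if true  = ≈-refl
    split-if false = ≈-sym (*-identityˡ 1#)

  bikeyGF≈partitionGF : ∀ n ℓ s x y → bikeyGF n ℓ s x y ≈ partitionGF n ℓ s x y
  bikeyGF≈partitionGF n ℓ s x y = begin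
    sumList (List.map (bikeyTerm x y) (bikeys n ℓ s))
      ≈⟨ sumList-map-cong (bikeyTerm≈weight x y) (bikeys n ℓ s) ⟩
    sumList (List.map (weight x y ∘ degrees) (bikeys n ℓ s))
      ≡⟨ cong sumList (List.map-∘ (bikeys n ℓ s)) ⟩
    sumList (List.map (weight x y) (List.map degrees (bikeys n ℓ s)))
      ≈⟨ sumList-↭ (↭.map⁺ (weight x y) degrees↭exponentPairs) ⟩
    sumList (List.map (weight x y) (exponentPairs n ℓ s))
      ≈⟨ sumList-concatMap (weight x y) (rearrangementPairs ℓ) (partitions n ℓ s) ⟩
    sumList (List.map (sumList ∘ List.map (weight x y) ∘ rearrangementPairs ℓ) (partitions n ℓ s))
      ≈⟨ sumList-map-cong (λ λp → ≈-sym (sumList-cartesianProduct (monomial x) (monomial y)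
                                          (rearrangements λp) (rearrangements (conj ℓ λp))))
                          (partitions n ℓ s) ⟩
    partitionGF n ℓ s x y
      ∎

corollary2p33 : ∀ {c r : Level} (n ℓ s : ℕ) → 2 ≤ n → 2 ≤ ℓ →
    ((M : BinMat n ℓ) → InK s M ⇔ InUnion s M)
    × ((R : CommutativeSemiring c r)
       (x : Fin n → CommutativeSemiring.Carrier R)
       (y : Fin ℓ → CommutativeSemiring.Carrier R) →
       CommutativeSemiring._≈_ R (Poly.bikeyGF R n ℓ s x y) (Poly.partitionGF R n ℓ s x y))
corollary2p33 n ℓ s _ _ = bikeyMatrix⇔placedPartition s , λ R → Sums.bikeyGF≈partitionGF R n ℓ s
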